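{- Let $p$ be an odd prime, $\Phi_p=\{g\in GL_2(\mathbb{Z}/p\mathbb{Z}):\det(1-g)\ne0\}$, and $\psi_p(\sigma)=\left(\frac{\det\sigma}{p}\right)$. Then $|\Phi_p|=p(p^3-2p^2-p+3)$ and \[ |\psi_p^{ -1}(1)\cap\Phi_p|-|\psi_p^{ -1}(-1)\cap\Phi_p|=p. \]
   Context: $\left(\frac{\cdot}{p}\right)$ is the Legendre symbol. -}

module Defs where

open import Data.Nat using (ℕ; zero; suc; _+_; _*_; _∸_; _%_; NonZero)
open import Data.Nat.Properties using (_≟_)
open import Data.Fin using (Fin; toℕ)
open import Data.List using (List; length; filter; cartesianProduct; map; allFin)
open import Data.Product using (_×_; _,_; ∃-syntax)
open import Data.Fin.Properties using (any?)
open import Data.Integer using (ℤ) renaming (0ℤ to 0ℤ; 1ℤ to 1ℤ; -1ℤ to -1ℤ)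
open import Data.Integer.Properties using () renaming (_≟_ to _ℤ≟_)
open import Relation.Nullary using (¬_; Dec; yes; no)
open import Relation.Nullary.Decidable using (_×-dec_; ¬?)
open import Relation.Unary using (Decidable)
open import Relation.Binary.PropositionalEquality using (_≡_)

-- Elements of ℤ/pℤ are represented by Fin p (residues 0..p-1);
-- arithmetic is done on representatives in ℕ and reduced mod p.

-- A 2×2 matrix over ℤ/pℤ, (a , b , c , d) standing for [[a , b] , [c , d]].
Mat2 : ℕ → Set
Mat2 p = Fin p × Fin p × Fin p × Fin p

allMat2 : (p : ℕ) → List (Mat2 p)
allMat2 p = cartesianProduct (allFin p)
              (cartesianProduct (allFin p) (cartesianProduct (allFin p) (allFin p)))

subMod : (p : ℕ) → .{{_ : NonZero p}} → ℕ → ℕ → ℕ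
subMod p x y = (x + (p ∸ (y % p))) % p

detMod : (p : ℕ) → .{{_ : NonZero p}} → Mat2 p → ℕ
detMod p (a , b , c , d) = subMod p (toℕ a * toℕ d) (toℕ b * toℕ c)

-- det (1 - g) mod p = (1 - a)(1 - d) - (-b)(-c) = (1-a)(1-d) - b c
det1MinusMod : (p : ℕ) → .{{_ : NonZero p}} → Mat2 p → ℕ
det1MinusMod p (a , b , c , d) =
  subMod p (subMod p 1 (toℕ a) * subMod p 1 (toℕ d)) (toℕ b * toℕ c)

InGL2 : (p : ℕ) → .{{_ : NonZero p}} → Mat2 p → Set
InGL2 p g = ¬ (detMod p g ≡ 0)

InΦ : (p : ℕ) → .{{_ : NonZero p}} → Mat2 p → Set
InΦ p g = InGL2 p g × ¬ (det1MinusMod p g ≡ 0)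

inΦ? : (p : ℕ) → .{{_ : NonZero p}} → Decidable (InΦ p)
inΦ? p g = ¬? (detMod p g ≟ 0) ×-dec ¬? (det1MinusMod p g ≟ 0)

IsSquareMod : (p : ℕ) → .{{_ : NonZero p}} → ℕ → Set
IsSquareMod p x = ∃[ y ] ((toℕ {p} y * toℕ y) % p ≡ x % p)

isSquareMod? : (p : ℕ) → .{{_ : NonZero p}} → Decidable (IsSquareMod p)
isSquareMod? p x = any? (λ y → (toℕ y * toℕ y) % p ≟ x % p)

legendre : (p : ℕ) → .{{_ : NonZero p}} → ℕ → ℤ
legendre p x with x % p ≟ 0
... | yes _ = 0ℤ
... | no _ with isSquareMod? p x
...   | yes _ = 1ℤ
...   | no _ = -1ℤ

ψ : (p : ℕ) → .{{_ : NonZero p}} → Mat2 p → ℤ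
ψ p g = legendre p (detMod p g)

Φ : (p : ℕ) → .{{_ : NonZero p}} → List (Mat2 p)
Φ p = filter (inΦ? p) (allMat2 p)

countψΦ : (p : ℕ) → .{{_ : NonZero p}} → ℤ → ℕ
countψΦ p v = length (filter (λ g → ψ p g ℤ≟ v) (Φ p))

module Submission where

-- Both statements are instances of one weighted count: for any function h
-- on residues,
--   Σ_{g ∈ Φ_p} h(det g) = p·( q²·(Σ_x h(x) − h(0)) + Σ_{a,d ∉ {0,1}} h(ad) ),
-- where q = p − 1.  Write g = (a b ; c d) and k = bc; det g = ad − k and
-- det(1 − g) = (1 − a)(1 − d) − k depend only on a, d and k.  The sum over
-- (b, c) is p times the k = 0 term plus q times the sum over all k (for
-- b ≠ 0, c ↦ bc permutes the residues).  The k = 0 terms are the diagonal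
-- matrices, which lie in Φ_p iff a, d ∉ {0, 1}.  In the sum over k, put
-- u = ad − k: the conditions become u ≠ 0 and u ≠ a + d − 1, and the
-- excluded value a + d − 1 runs over all residues as d does.  Taking h = 1
-- gives the cardinality; taking h = χ, the quadratic character, and using
-- Σ χ = 0 (every non-zero square has exactly two square roots) gives the
-- signed count.

open import Data.Nat using (ℕ; zero; suc)
open import Data.Nat.Primality using (Prime)
open import Relation.Binary.PropositionalEquality using (_≢_)

module FiniteSums where

  open import Data.Integer using (ℤ; +_; 0ℤ; 1ℤ; -1ℤ; _+_; _*_; _-_; -_)
  import Data.Integer.Properties as ℤP
  open import Data.Integer.Tactic.RingSolver using (solve-∀)
  open import Data.Fin as Fin using (Fin)
  import Data.Fin.Properties as FinP
  open import Data.List using (List; []; _∷_; _++_; map; filter; length; tabulate; allFin; cartesianProduct)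
  open import Data.Product using (_×_; _,_)
  open import Data.Sum using (_⊎_; inj₁; inj₂)
  open import Function using (id; _∘_; _⇔_; mk⇔; Equivalence)
  open import Relation.Nullary using (¬_; Dec; yes; no; contradiction)
  open import Relation.Nullary.Decidable using (_×-dec_; ¬?)
  open import Relation.Unary using (Decidable)
  open import Relation.Binary.PropositionalEquality using (_≡_; refl; sym; trans; cong; cong₂; module ≡-Reasoning)
  open import Algebra.Properties.Semiring.Sum ℤP.+-*-semiring
    using (sum; sum-cong-≗; ∑-distrib-+; *-distribˡ-sum)

  𝟙 : ∀ {a} {A : Set a} → Dec A → ℤ
  𝟙 (yes _) = 1ℤ
  𝟙 (no _)  = 0ℤ

  𝟙-cong : ∀ {a b} {A : Set a} {B : Set b} → A ⇔ B → (a : Dec A) (b : Dec B) → 𝟙 a ≡ 𝟙 b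
  𝟙-cong A⇔B (yes _) (yes _) = refl
  𝟙-cong A⇔B (yes x) (no ¬y) = contradiction (Equivalence.to A⇔B x) ¬y
  𝟙-cong A⇔B (no ¬x) (yes y) = contradiction (Equivalence.from A⇔B y) ¬x
  𝟙-cong A⇔B (no _)  (no _)  = refl

  𝟙-yes : ∀ {a} {A : Set a} → A → (a : Dec A) → 𝟙 a ≡ 1ℤ
  𝟙-yes x (yes _) = refl
  𝟙-yes x (no ¬x) = contradiction x ¬x

  𝟙-no : ∀ {a} {A : Set a} → ¬ A → (a : Dec A) → 𝟙 a ≡ 0ℤ
  𝟙-no ¬x (yes x) = contradiction x ¬x
  𝟙-no ¬x (no _)  = refl

  𝟙-× : ∀ {a b} {A : Set a} {B : Set b} (a : Dec A) (b : Dec B) → 𝟙 (a ×-dec b) ≡ 𝟙 a * 𝟙 b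
  𝟙-× (yes _) (yes _) = refl
  𝟙-× (yes _) (no _)  = refl
  𝟙-× (no _)  (yes _) = refl
  𝟙-× (no _)  (no _)  = refl

  𝟙-¬ : ∀ {a} {A : Set a} (a : Dec A) (x : ℤ) → 𝟙 (¬? a) * x ≡ x - 𝟙 a * x
  𝟙-¬ (yes _) = solve-∀
  𝟙-¬ (no _)  = solve-∀

  ∑-const : ∀ {n} (c : ℤ) → sum {n} (λ _ → c) ≡ + n * c
  ∑-const {zero}  c = refl
  ∑-const {suc n} c = trans (cong (_+_ c) (∑-const {n} c)) (step (+ n) c)
    where
    step : ∀ m c → c + m * c ≡ (1ℤ + m) * c
    step = solve-∀

  ∑-neg : ∀ {n} (f : Fin n → ℤ) → sum (λ i → - f i) ≡ - sum f
  ∑-neg {zero}  f = refl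
  ∑-neg {suc n} f = trans (cong (_+_ (- f Fin.zero)) (∑-neg (f ∘ Fin.suc)))
                          (sym (ℤP.neg-distrib-+ (f Fin.zero) (sum (f ∘ Fin.suc))))

  ∑-distrib-− : ∀ {n} (f g : Fin n → ℤ) → sum (λ i → f i - g i) ≡ sum f - sum g
  ∑-distrib-− f g = trans (∑-distrib-+ f (λ i → - g i)) (cong (_+_ (sum f)) (∑-neg g))

  ∑-*ˡ : ∀ {n} (c : ℤ) (f : Fin n → ℤ) → sum (λ i → c * f i) ≡ c * sum f
  ∑-*ˡ c f = sym (*-distribˡ-sum c f)

  ∑-δ : ∀ {n} (j : Fin n) (f : Fin n → ℤ) → sum (λ k → 𝟙 (j FinP.≟ k) * f k) ≡ f j
  ∑-δ {suc n} Fin.zero f = begin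
    1ℤ * f Fin.zero + sum (λ k → 0ℤ * f (Fin.suc k))  ≡⟨ cong (_+_ (1ℤ * f Fin.zero)) (∑-const {n} 0ℤ) ⟩
    1ℤ * f Fin.zero + + n * 0ℤ                         ≡⟨ lemma (f Fin.zero) (+ n) ⟩
    f Fin.zero                                         ∎
    where
    open ≡-Reasoning
    lemma : ∀ x m → 1ℤ * x + m * 0ℤ ≡ x
    lemma = solve-∀
  ∑-δ {suc n} (Fin.suc j) f = begin
    0ℤ * f Fin.zero + sum (λ k → 𝟙 (Fin.suc j FinP.≟ Fin.suc k) * f (Fin.suc k))
      ≡⟨ cong (_+_ (0ℤ * f Fin.zero)) (sum-cong-≗ (λ k → cong (_* f (Fin.suc k))
           (𝟙-cong suc⇔ (Fin.suc j FinP.≟ Fin.suc k) (j FinP.≟ k)))) ⟩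
    0ℤ * f Fin.zero + sum (λ k → 𝟙 (j FinP.≟ k) * f (Fin.suc k))
      ≡⟨ cong (_+_ (0ℤ * f Fin.zero)) (∑-δ j (f ∘ Fin.suc)) ⟩
    0ℤ * f Fin.zero + f (Fin.suc j)
      ≡⟨ ℤP.+-identityˡ _ ⟩
    f (Fin.suc j) ∎
    where
    open ≡-Reasoning
    suc⇔ : ∀ {k} → (Fin.suc j ≡ Fin.suc k) ⇔ (j ≡ k)
    suc⇔ = mk⇔ FinP.suc-injective (cong Fin.suc)

  listSum : ∀ {a} {A : Set a} → List A → (A → ℤ) → ℤ
  listSum []       f = 0ℤ
  listSum (x ∷ xs) f = f x + listSum xs f

  listSum-cong : ∀ {a} {A : Set a} (xs : List A) {f g : A → ℤ} → (∀ x → f x ≡ g x) → listSum xs f ≡ listSum xs g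
  listSum-cong []       f≗g = refl
  listSum-cong (x ∷ xs) f≗g = cong₂ _+_ (f≗g x) (listSum-cong xs f≗g)

  listSum-++ : ∀ {a} {A : Set a} (xs ys : List A) (f : A → ℤ) → listSum (xs ++ ys) f ≡ listSum xs f + listSum ys f
  listSum-++ []       ys f = sym (ℤP.+-identityˡ _)
  listSum-++ (x ∷ xs) ys f = trans (cong (_+_ (f x)) (listSum-++ xs ys f)) (sym (ℤP.+-assoc (f x) _ _))

  listSum-map : ∀ {a b} {A : Set a} {B : Set b} (g : A → B) (xs : List A) (f : B → ℤ) →
    listSum (map g xs) f ≡ listSum xs (f ∘ g)
  listSum-map g []       f = refl
  listSum-map g (x ∷ xs) f = cong (_+_ (f (g x))) (listSum-map g xs f)

  listSum-− : ∀ {a} {A : Set a} (xs : List A) (f g : A → ℤ) →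
    listSum xs f - listSum xs g ≡ listSum xs (λ x → f x - g x)
  listSum-− []       f g = refl
  listSum-− (x ∷ xs) f g = trans (regroup (f x) (g x) (listSum xs f) (listSum xs g))
                                 (cong (_+_ (f x - g x)) (listSum-− xs f g))
    where
    regroup : ∀ a b c d → (a + c) - (b + d) ≡ (a - b) + (c - d)
    regroup = solve-∀

  listSum-allFin : ∀ n (f : Fin n → ℤ) → listSum (allFin n) f ≡ sum f
  listSum-allFin n = go id
    where
    go : ∀ {m} {A : Set} (g : Fin m → A) (f : A → ℤ) → listSum (tabulate g) f ≡ sum (f ∘ g)
    go {zero}  g f = refl
    go {suc m} g f = cong (_+_ (f (g Fin.zero))) (go (g ∘ Fin.suc) f)

  listSum-cartesian : ∀ {a b} {A : Set a} {B : Set b} (xs : List A) (ys : List B) (f : A × B → ℤ) →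
    listSum (cartesianProduct xs ys) f ≡ listSum xs (λ x → listSum ys (λ y → f (x , y)))
  listSum-cartesian []       ys f = refl
  listSum-cartesian (x ∷ xs) ys f = begin
    listSum (map (x ,_) ys ++ cartesianProduct xs ys) f
      ≡⟨ listSum-++ (map (x ,_) ys) _ f ⟩
    listSum (map (x ,_) ys) f + listSum (cartesianProduct xs ys) f
      ≡⟨ cong₂ _+_ (listSum-map (x ,_) ys f) (listSum-cartesian xs ys f) ⟩
    listSum ys (λ y → f (x , y)) + listSum xs (λ x′ → listSum ys (λ y → f (x′ , y))) ∎
    where open ≡-Reasoning

  listSum-filter : ∀ {a p} {A : Set a} {P : A → Set p} (P? : Decidable P) (xs : List A) (f : A → ℤ) →
    listSum (filter P? xs) f ≡ listSum xs (λ x → 𝟙 (P? x) * f x)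
  listSum-filter P? []       f = refl
  listSum-filter P? (x ∷ xs) f with P? x
  ... | yes _ = cong₂ _+_ (sym (ℤP.*-identityˡ (f x))) (listSum-filter P? xs f)
  ... | no _  = trans (listSum-filter P? xs f) (sym (ℤP.+-identityˡ _))

  length-listSum : ∀ {a} {A : Set a} (xs : List A) → + length xs ≡ listSum xs (λ _ → 1ℤ)
  length-listSum []       = refl
  length-listSum (x ∷ xs) = trans (ℤP.pos-+ 1 (length xs)) (cong (_+_ 1ℤ) (length-listSum xs))

  signed-count : ∀ {a} {A : Set a} (f : A → ℤ) → (∀ x → f x ≡ 0ℤ ⊎ f x ≡ 1ℤ ⊎ f x ≡ -1ℤ) → (xs : List A) →
    + length (filter (λ x → f x ℤP.≟ 1ℤ) xs) - + length (filter (λ x → f x ℤP.≟ -1ℤ) xs) ≡ listSum xs f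
  signed-count {A = A} f sign xs = begin
    + length (filter (λ x → f x ℤP.≟ 1ℤ) xs) - + length (filter (λ x → f x ℤP.≟ -1ℤ) xs)
      ≡⟨ cong₂ _-_ (count (λ x → f x ℤP.≟ 1ℤ)) (count (λ x → f x ℤP.≟ -1ℤ)) ⟩
    listSum xs (λ x → 𝟙 (f x ℤP.≟ 1ℤ)) - listSum xs (λ x → 𝟙 (f x ℤP.≟ -1ℤ))
      ≡⟨ listSum-− xs _ _ ⟩
    listSum xs (λ x → 𝟙 (f x ℤP.≟ 1ℤ) - 𝟙 (f x ℤP.≟ -1ℤ))
      ≡⟨ listSum-cong xs (λ x → pointwise (f x) (sign x)) ⟩
    listSum xs f ∎
    where
    open ≡-Reasoning
    count : ∀ {p} {P : A → Set p} (P? : Decidable P) → + length (filter P? xs) ≡ listSum xs (λ x → 𝟙 (P? x))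
    count P? = trans (length-listSum (filter P? xs))
                     (trans (listSum-filter P? xs _) (listSum-cong xs (λ x → ℤP.*-identityʳ (𝟙 (P? x)))))
    pointwise : ∀ v → v ≡ 0ℤ ⊎ v ≡ 1ℤ ⊎ v ≡ -1ℤ → 𝟙 (v ℤP.≟ 1ℤ) - 𝟙 (v ℤP.≟ -1ℤ) ≡ v
    pointwise _ (inj₁ refl)        = refl
    pointwise _ (inj₂ (inj₁ refl)) = refl
    pointwise _ (inj₂ (inj₂ refl)) = refl

-- Residues modulo p = q + 1, represented by natural numbers and compared by
-- congruence.  Nothing here uses primality; q plays the role of −1.
module Residues (q : ℕ) where

  open import Data.Nat using (_+_; _*_; _∸_; _%_; _<_)
  import Data.Nat.Properties as ℕP
  open import Data.Nat.DivMod using (m%n%n≡m%n; [m+kn]%n≡m%n; %-distribˡ-+; %-distribˡ-*; m%n<n; m<n⇒m%n≡m; n%n≡0)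
  open import Data.Nat.Tactic.RingSolver using (solve-∀)
  open import Data.Fin using (Fin; toℕ; fromℕ<)
  import Data.Fin.Properties as FinP
  open import Data.Fin.Permutation using (Permutation; permutation; _⟨$⟩ʳ_)
  open import Function using (_⇔_; mk⇔; Equivalence)
  open import Data.Product using (Σ; _,_)
  open import Relation.Nullary using (¬_; Dec; yes; no)
  open import Relation.Binary using (Setoid; IsEquivalence)
  open import Relation.Binary.PropositionalEquality using (_≡_; refl; sym; trans; cong; cong₂; module ≡-Reasoning)
  import Relation.Binary.Reasoning.Setoid as SetoidReasoning
  open import Defs using (subMod)

  p : ℕ
  p = suc q

  infix 4 _≈_ _≈?_

  record _≈_ (x y : ℕ) : Set where
    constructor mk
    field same-rem : x % p ≡ y % p

  _≈?_ : ∀ x y → Dec (x ≈ y)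
  x ≈? y with x % p ℕP.≟ y % p
  ... | yes e = yes (mk e)
  ... | no ¬e = no (λ e → ¬e (_≈_.same-rem e))

  ≈-isEquivalence : IsEquivalence _≈_
  ≈-isEquivalence = record
    { refl  = mk refl
    ; sym   = λ (mk e) → mk (sym e)
    ; trans = λ (mk e) (mk f) → mk (trans e f)
    }

  ≈-setoid : Setoid _ _
  ≈-setoid = record { isEquivalence = ≈-isEquivalence }

  open IsEquivalence ≈-isEquivalence public
    using () renaming (refl to ≈-refl; sym to ≈-sym; trans to ≈-trans)
  module ≈-Reasoning = SetoidReasoning ≈-setoid

  ≡⇒≈ : ∀ {x y} → x ≡ y → x ≈ y
  ≡⇒≈ e = mk (cong (_% p) e)

  %-≈ : ∀ x → x % p ≈ x
  %-≈ x = mk (m%n%n≡m%n x p)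

  +-cong : ∀ {x x′ y y′} → x ≈ x′ → y ≈ y′ → x + y ≈ x′ + y′
  +-cong {x} {x′} {y} {y′} (mk e) (mk f) = mk (begin
    (x + y) % p                ≡⟨ %-distribˡ-+ x y p ⟩
    (x % p + y % p) % p        ≡⟨ cong₂ (λ u v → (u + v) % p) e f ⟩
    (x′ % p + y′ % p) % p      ≡⟨ %-distribˡ-+ x′ y′ p ⟨
    (x′ + y′) % p              ∎)
    where open ≡-Reasoning

  *-cong : ∀ {x x′ y y′} → x ≈ x′ → y ≈ y′ → x * y ≈ x′ * y′
  *-cong {x} {x′} {y} {y′} (mk e) (mk f) = mk (begin
    (x * y) % p                ≡⟨ %-distribˡ-* x y p ⟩
    (x % p * (y % p)) % p      ≡⟨ cong₂ (λ u v → (u * v) % p) e f ⟩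
    (x′ % p * (y′ % p)) % p    ≡⟨ %-distribˡ-* x′ y′ p ⟨
    (x′ * y′) % p              ∎)
    where open ≡-Reasoning

  +-congˡ : ∀ x {y z} → y ≈ z → x + y ≈ x + z
  +-congˡ x = +-cong (≈-refl {x})

  +-congʳ : ∀ x {y z} → y ≈ z → y + x ≈ z + x
  +-congʳ x y≈z = +-cong y≈z (≈-refl {x})

  *-congˡ : ∀ x {y z} → y ≈ z → x * y ≈ x * z
  *-congˡ x = *-cong (≈-refl {x})

  *-congʳ : ∀ x {y z} → y ≈ z → y * x ≈ z * x
  *-congʳ x y≈z = *-cong y≈z (≈-refl {x})

  +-multiple : ∀ x k → x + k * p ≈ x
  +-multiple x k = mk ([m+kn]%n≡m%n x k p)

  p≈0 : p ≈ 0
  p≈0 = mk (n%n≡0 p)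

  below-p≉0 : ∀ {n} → suc n < p → ¬ suc n ≈ 0
  below-p≉0 n<p (mk e) with trans (sym (m<n⇒m%n≡m n<p)) e
  ... | ()

  -- Cancellation: add q·z, turning z into a multiple of p.
  +-cancelʳ : ∀ {x y} z → x + z ≈ y + z → x ≈ y
  +-cancelʳ {x} {y} z e = begin
    x                   ≈⟨ +-multiple x z ⟨
    x + z * p           ≡⟨ regroup q x z ⟩
    (x + z) + q * z     ≈⟨ +-congʳ (q * z) e ⟩
    (y + z) + q * z     ≡⟨ regroup q y z ⟨
    y + z * p           ≈⟨ +-multiple y z ⟩
    y                   ∎
    where
    open ≈-Reasoning
    regroup : ∀ q x z → x + z * suc q ≡ (x + z) + q * z
    regroup = solve-∀

  +-cancelˡ : ∀ {x y} z → z + x ≈ z + y → x ≈ y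
  +-cancelˡ {x} {y} z e = +-cancelʳ z (≈-trans (≡⇒≈ (ℕP.+-comm x z)) (≈-trans e (≡⇒≈ (ℕP.+-comm z y))))

  +≈0⇔ : ∀ {x y} → x + y ≈ 0 ⇔ x ≈ q * y
  +≈0⇔ {x} {y} = mk⇔ to from
    where
    open ≈-Reasoning
    to : x + y ≈ 0 → x ≈ q * y
    to e = begin
      x                 ≈⟨ +-multiple x y ⟨
      x + y * p         ≡⟨ regroup q x y ⟩
      (x + y) + q * y   ≈⟨ +-congʳ (q * y) e ⟩
      q * y             ∎
      where
      regroup : ∀ q x y → x + y * suc q ≡ (x + y) + q * y
      regroup = solve-∀
    from : x ≈ q * y → x + y ≈ 0
    from e = begin
      x + y             ≈⟨ +-congʳ y e ⟩
      q * y + y         ≡⟨ regroup q y ⟩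
      0 + y * p         ≈⟨ +-multiple 0 y ⟩
      0                 ∎
      where
      regroup : ∀ q y → q * y + y ≡ 0 + y * suc q
      regroup = solve-∀

  q*q≈1 : q * q ≈ 1
  q*q≈1 = ≈-sym (Equivalence.to (+≈0⇔ {1} {q}) p≈0)

  neg-involutive : ∀ x → q * (q * x) ≈ x
  neg-involutive x = begin
    q * (q * x)   ≡⟨ ℕP.*-assoc q q x ⟨
    (q * q) * x   ≈⟨ *-congʳ x q*q≈1 ⟩
    1 * x         ≡⟨ ℕP.*-identityˡ x ⟩
    x             ∎
    where open ≈-Reasoning

  sub≈⇔ : ∀ {x y z} → subMod p x y ≈ z ⇔ x ≈ z + y
  sub≈⇔ {x} {y} {z} = mk⇔ to from
    where
    open ≈-Reasoning
    r = p ∸ y % p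
    r+y≈0 : r + y ≈ 0
    r+y≈0 = begin
      r + y         ≈⟨ +-congˡ r (%-≈ y) ⟨
      r + y % p     ≡⟨ ℕP.m∸n+n≡m (ℕP.<⇒≤ (m%n<n y p)) ⟩
      p             ≈⟨ p≈0 ⟩
      0             ∎
    to : subMod p x y ≈ z → x ≈ z + y
    to e = begin
      x             ≡⟨ ℕP.+-identityʳ x ⟨
      x + 0         ≈⟨ +-congˡ x r+y≈0 ⟨
      x + (r + y)   ≡⟨ ℕP.+-assoc x r y ⟨
      x + r + y     ≈⟨ +-congʳ y (≈-trans (≈-sym (%-≈ (x + r))) e) ⟩
      z + y         ∎
    from : x ≈ z + y → subMod p x y ≈ z
    from e = begin
      (x + r) % p   ≈⟨ %-≈ (x + r) ⟩
      x + r         ≈⟨ +-congʳ r e ⟩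
      z + y + r     ≡⟨ ℕP.+-assoc z y r ⟩
      z + (y + r)   ≈⟨ +-congˡ z (≈-trans (≡⇒≈ (ℕP.+-comm y r)) r+y≈0) ⟩
      z + 0         ≡⟨ ℕP.+-identityʳ z ⟩
      z             ∎

  sub≈ : ∀ x y → subMod p x y ≈ x + q * y
  sub≈ x y = Equivalence.from sub≈⇔ (begin
    x                 ≈⟨ +-multiple x y ⟨
    x + y * p         ≡⟨ regroup q x y ⟩
    x + q * y + y     ∎)
    where
    open ≈-Reasoning
    regroup : ∀ q x y → x + y * suc q ≡ x + q * y + y
    regroup = solve-∀

  -- Defs tests residues for zero on the reduced representative.
  sub≡0⇔ : ∀ {x y} → subMod p x y ≡ 0 ⇔ x ≈ y
  sub≡0⇔ {x} {y} = mk⇔ (λ e → Equivalence.to (sub≈⇔ {x} {y} {0}) (≡⇒≈ e)) from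
    where
    from : x ≈ y → subMod p x y ≡ 0
    from e = trans (sym (m<n⇒m%n≡m (m%n<n (x + (p ∸ y % p)) p)))
                   (_≈_.same-rem (Equivalence.from (sub≈⇔ {x} {y} {0}) e))

  sub-congʳ : ∀ x {y y′} → y ≈ y′ → subMod p x y ≈ subMod p x y′
  sub-congʳ x {y} {y′} y≈y′ =
    ≈-trans (sub≈ x y) (≈-trans (+-congˡ x (*-congˡ q y≈y′)) (≈-sym (sub≈ x y′)))

  sub-cancelˡ⇔ : ∀ {x y z} → subMod p x y ≈ subMod p x z ⇔ y ≈ z
  sub-cancelˡ⇔ {x} {y} {z} = mk⇔
    (λ e → ≈-sym (+-cancelˡ (subMod p x z) (≈-trans (≈-sym x≈) (Equivalence.to sub≈⇔ e))))
    (λ y≈z → sub-congʳ x y≈z)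
    where
    x≈ : x ≈ subMod p x z + z
    x≈ = Equivalence.to sub≈⇔ ≈-refl

  -- ad − (1 − a)(1 − d) ≈ d + a − 1: for fixed a it is a translate of d.
  diagonal-shift : ∀ a d → subMod p (a * d) (subMod p 1 a * subMod p 1 d) ≈ 1 * d + (a + q)
  diagonal-shift a d = ≈-sym (+-cancelʳ (X * Y) (begin
    1 * d + (a + q) + X * Y                        ≈⟨ +-congˡ (1 * d + (a + q)) (*-cong (sub≈ 1 a) (sub≈ 1 d)) ⟩
    1 * d + (a + q) + (1 + q * a) * (1 + q * d)    ≡⟨ expand q a d ⟩
    q * q * (a * d) + (1 + a + d) * p              ≈⟨ +-multiple _ (1 + a + d) ⟩
    q * q * (a * d)                                ≈⟨ *-congʳ (a * d) q*q≈1 ⟩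
    1 * (a * d)                                    ≡⟨ ℕP.*-identityˡ (a * d) ⟩
    a * d                                          ≈⟨ Equivalence.to sub≈⇔ ≈-refl ⟩
    subMod p (a * d) (X * Y) + X * Y               ∎))
    where
    open ≈-Reasoning
    X = subMod p 1 a
    Y = subMod p 1 d
    expand : ∀ q a d → 1 * d + (a + q) + (1 + q * a) * (1 + q * d) ≡ q * q * (a * d) + (1 + a + d) * suc q
    expand = solve-∀

  fm : ℕ → Fin p
  fm x = fromℕ< (m%n<n x p)

  toℕ-fm : ∀ x → toℕ (fm x) ≈ x
  toℕ-fm x = ≈-trans (≡⇒≈ (FinP.toℕ-fromℕ< (m%n<n x p))) (%-≈ x)

  fm-unique : ∀ {x} {k : Fin p} → x ≈ toℕ k → fm x ≡ k
  fm-unique {x} {k} (mk e) = FinP.toℕ-injective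
    (trans (FinP.toℕ-fromℕ< (m%n<n x p)) (trans e (m<n⇒m%n≡m (FinP.toℕ<n k))))

  Invertible : ℕ → Set
  Invertible u = Σ ℕ (λ w → u * w ≈ 1)

  affine-permutation : ∀ u → Invertible u → ℕ → Permutation p p
  affine-permutation u (w , uw≈1) v = permutation to from to∘from from∘to
    where
    to : Fin p → Fin p
    to i = fm (u * toℕ i + v)
    from : Fin p → Fin p
    from k = fm (w * (toℕ k + q * v))
    wu≈1 : w * u ≈ 1
    wu≈1 = ≈-trans (≡⇒≈ (ℕP.*-comm w u)) uw≈1
    to∘from : ∀ k → to (from k) ≡ k
    to∘from k = fm-unique (begin
      u * toℕ (fm (w * (K + q * v))) + v      ≈⟨ +-congʳ v (*-congˡ u (toℕ-fm (w * (K + q * v)))) ⟩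
      u * (w * (K + q * v)) + v               ≡⟨ regroup u w (K + q * v) v ⟩
      (u * w) * (K + q * v) + v               ≈⟨ +-congʳ v (*-congʳ (K + q * v) uw≈1) ⟩
      1 * (K + q * v) + v                     ≡⟨ collect q K v ⟩
      K + v * p                               ≈⟨ +-multiple K v ⟩
      K                                       ∎)
      where
      open ≈-Reasoning
      K = toℕ k
      regroup : ∀ u w X v → u * (w * X) + v ≡ (u * w) * X + v
      regroup = solve-∀
      collect : ∀ q K v → 1 * (K + q * v) + v ≡ K + v * suc q
      collect = solve-∀
    from∘to : ∀ i → from (to i) ≡ i
    from∘to i = fm-unique (begin
      w * (toℕ (fm (u * I + v)) + q * v)      ≈⟨ *-congˡ w (+-congʳ (q * v) (toℕ-fm (u * I + v))) ⟩
      w * (u * I + v + q * v)                 ≡⟨ regroup q u w I v ⟩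
      (w * u) * I + (w * v) * p               ≈⟨ +-multiple _ (w * v) ⟩
      (w * u) * I                             ≈⟨ *-congʳ I wu≈1 ⟩
      1 * I                                   ≡⟨ ℕP.*-identityˡ I ⟩
      I                                       ∎)
      where
      open ≈-Reasoning
      I = toℕ i
      regroup : ∀ q u w I v → w * (u * I + v + q * v) ≡ (w * u) * I + (w * v) * suc q
      regroup = solve-∀

  affine-permutation-≈ : ∀ u (u⁻¹ : Invertible u) v i →
    toℕ (affine-permutation u u⁻¹ v ⟨$⟩ʳ i) ≈ u * toℕ i + v
  affine-permutation-≈ u u⁻¹ v i = toℕ-fm (u * toℕ i + v)

module ResidueSums (q : ℕ) where

  open Residues q
  open FiniteSums using (𝟙; 𝟙-cong; 𝟙-¬; ∑-const; ∑-distrib-−; ∑-*ˡ; ∑-δ)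
  open import Function.Related.TypeIsomorphisms using (¬-cong-⇔)
  open import Data.Nat as ℕ using ()
  open import Data.Integer using (ℤ; +_; 1ℤ; _+_; _*_; _-_)
  import Data.Integer.Properties as ℤP
  open import Data.Fin using (Fin; toℕ)
  import Data.Fin.Properties as FinP
  open import Data.Fin.Permutation using (_⟨$⟩ʳ_)
  open import Function using (_⇔_; mk⇔)
  open import Relation.Nullary.Decidable using (¬?)
  open import Relation.Binary.PropositionalEquality using (_≡_; refl; sym; trans; cong; cong₂; module ≡-Reasoning)
  open import Algebra.Properties.Semiring.Sum ℤP.+-*-semiring using (sum; sum-cong-≗; ∑-distrib-+; ∑-comm; ∑-permute)

  ∑ₚ : (ℕ → ℤ) → ℤ
  ∑ₚ f = sum (λ (k : Fin p) → f (toℕ k))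

  ∑ₚ-cong : ∀ {f g : ℕ → ℤ} → (∀ x → f x ≡ g x) → ∑ₚ f ≡ ∑ₚ g
  ∑ₚ-cong f≗g = sum-cong-≗ {p} (λ k → f≗g (toℕ k))

  ∑ₚ-const : ∀ c → ∑ₚ (λ _ → c) ≡ + p * c
  ∑ₚ-const c = ∑-const {p} c

  ∑ₚ-+ : ∀ f g → ∑ₚ (λ x → f x + g x) ≡ ∑ₚ f + ∑ₚ g
  ∑ₚ-+ f g = ∑-distrib-+ {p} (λ k → f (toℕ k)) (λ k → g (toℕ k))

  ∑ₚ-− : ∀ f g → ∑ₚ (λ x → f x - g x) ≡ ∑ₚ f - ∑ₚ g
  ∑ₚ-− f g = ∑-distrib-− {p} (λ k → f (toℕ k)) (λ k → g (toℕ k))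

  ∑ₚ-*ˡ : ∀ c f → ∑ₚ (λ x → c * f x) ≡ c * ∑ₚ f
  ∑ₚ-*ˡ c f = ∑-*ˡ {p} c (λ k → f (toℕ k))

  ∑ₚ-comm : ∀ (f : ℕ → ℕ → ℤ) → ∑ₚ (λ x → ∑ₚ (λ y → f x y)) ≡ ∑ₚ (λ y → ∑ₚ (λ x → f x y))
  ∑ₚ-comm f = ∑-comm {p} {p} (λ j k → f (toℕ j) (toℕ k))

  Respects≈ : (ℕ → ℤ) → Set
  Respects≈ f = ∀ {x y} → x ≈ y → f x ≡ f y

  ⟦_≈_⟧ : ℕ → ℕ → ℤ
  ⟦ x ≈ y ⟧ = 𝟙 (x ≈? y)

  ⟦_≉_⟧ : ℕ → ℕ → ℤ
  ⟦ x ≉ y ⟧ = 𝟙 (¬? (x ≈? y))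

  ⟦≉⟧-cong : ∀ {x x′ y y′} → x ≈ y ⇔ x′ ≈ y′ → ⟦ x ≉ y ⟧ ≡ ⟦ x′ ≉ y′ ⟧
  ⟦≉⟧-cong e = 𝟙-cong (¬-cong-⇔ e) (¬? (_ ≈? _)) (¬? (_ ≈? _))

  ⟦≉⟧-respects : ∀ {x x′ y y′} → x ≈ x′ → y ≈ y′ → ⟦ x ≉ y ⟧ ≡ ⟦ x′ ≉ y′ ⟧
  ⟦≉⟧-respects x≈x′ y≈y′ = ⟦≉⟧-cong (mk⇔ (λ e → ≈-trans (≈-sym x≈x′) (≈-trans e y≈y′))
                                         (λ e → ≈-trans x≈x′ (≈-trans e (≈-sym y≈y′))))

  restrict-respects : ∀ {f} → Respects≈ f → ∀ s → Respects≈ (λ x → ⟦ x ≉ s ⟧ * f x)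
  restrict-respects f-resp s x≈y = cong₂ _*_ (⟦≉⟧-respects x≈y ≈-refl) (f-resp x≈y)

  ⟦≈⟧-respects : ∀ {x x′ y y′} → x ≈ x′ → y ≈ y′ → ⟦ x ≈ y ⟧ ≡ ⟦ x′ ≈ y′ ⟧
  ⟦≈⟧-respects x≈x′ y≈y′ = 𝟙-cong (mk⇔ (λ e → ≈-trans (≈-sym x≈x′) (≈-trans e y≈y′))
                                       (λ e → ≈-trans x≈x′ (≈-trans e (≈-sym y≈y′))))
                                  (_ ≈? _) (_ ≈? _)

  ∑-delta : ∀ {f} → Respects≈ f → ∀ s → ∑ₚ (λ x → ⟦ x ≈ s ⟧ * f x) ≡ f s
  ∑-delta {f} f-resp s = begin
    ∑ₚ (λ x → ⟦ x ≈ s ⟧ * f x)                           ≡⟨ sum-cong-≗ (λ k → cong (_* f (toℕ k)) (as-δ k)) ⟩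
    sum (λ k → 𝟙 (fm s FinP.≟ k) * f (toℕ k))           ≡⟨ ∑-δ (fm s) (λ k → f (toℕ k)) ⟩
    f (toℕ (fm s))                                       ≡⟨ f-resp (toℕ-fm s) ⟩
    f s                                                  ∎
    where
    open ≡-Reasoning
    as-δ : ∀ k → ⟦ toℕ k ≈ s ⟧ ≡ 𝟙 (fm s FinP.≟ k)
    as-δ k = 𝟙-cong (mk⇔ (λ e → fm-unique (≈-sym e)) (λ { refl → toℕ-fm s }))
                    (toℕ k ≈? s) (fm s FinP.≟ k)

  ∑-point : ∀ s → ∑ₚ (λ x → ⟦ x ≈ s ⟧) ≡ 1ℤ
  ∑-point s = trans (∑ₚ-cong (λ x → sym (ℤP.*-identityʳ ⟦ x ≈ s ⟧))) (∑-delta (λ _ → refl) s)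

  ∑-except : ∀ {f} → Respects≈ f → ∀ s → ∑ₚ (λ x → ⟦ x ≉ s ⟧ * f x) ≡ ∑ₚ f - f s
  ∑-except {f} f-resp s = begin
    ∑ₚ (λ x → ⟦ x ≉ s ⟧ * f x)               ≡⟨ ∑ₚ-cong (λ x → 𝟙-¬ (x ≈? s) (f x)) ⟩
    ∑ₚ (λ x → f x - ⟦ x ≈ s ⟧ * f x)         ≡⟨ ∑ₚ-− f (λ x → ⟦ x ≈ s ⟧ * f x) ⟩
    ∑ₚ f - ∑ₚ (λ x → ⟦ x ≈ s ⟧ * f x)        ≡⟨ cong (∑ₚ f -_) (∑-delta f-resp s) ⟩
    ∑ₚ f - f s                               ∎
    where open ≡-Reasoning

  ∑-affine : ∀ {f} → Respects≈ f → ∀ u → Invertible u → ∀ v →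
    ∑ₚ (λ x → f (u ℕ.* x ℕ.+ v)) ≡ ∑ₚ f
  ∑-affine {f} f-resp u u⁻¹ v = sym (begin
    ∑ₚ f                                      ≡⟨ ∑-permute (λ k → f (toℕ k)) π ⟩
    sum (λ (i : Fin p) → f (toℕ (π ⟨$⟩ʳ i)))  ≡⟨ sum-cong-≗ {p} (λ i → f-resp (affine-permutation-≈ u u⁻¹ v i)) ⟩
    ∑ₚ (λ x → f (u ℕ.* x ℕ.+ v))              ∎)
    where
    open ≡-Reasoning
    π = affine-permutation u u⁻¹ v

module PrimeField (q : ℕ) (prime : Prime (suc q)) where

  open Residues q
  open import Data.Nat using (_+_; _*_; _%_; _<_; NonZero; ≢-nonZero; nonTrivial⇒n>1)
  import Data.Nat.Properties as ℕP
  open import Data.Nat.DivMod using (m%n<n)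
  open import Data.Nat.Divisibility using (m%n≡0⇒n∣m; n∣m⇒m%n≡0)
  open import Data.Nat.Primality using (euclidsLemma; prime⇒nonTrivial)
  open import Data.Nat.Coprimality using (coprime-Bézout; prime⇒coprime)
  open import Data.Nat.GCD using (module Bézout)
  open import Data.Nat.Tactic.RingSolver using (solve-∀)
  open import Data.Product using (_,_)
  open import Data.Sum as Sum using (_⊎_; inj₁; inj₂)
  open import Function using (Equivalence)
  open import Relation.Nullary using (¬_)
  open import Relation.Binary.PropositionalEquality using (_≡_; _≢_; sym; cong)

  1<p : 1 < p
  1<p = nonTrivial⇒n>1 p {{prime⇒nonTrivial prime}}

  1≉0 : ¬ 1 ≈ 0
  1≉0 = below-p≉0 1<p

  euclid : ∀ x y → x * y ≈ 0 → x ≈ 0 ⊎ y ≈ 0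
  euclid x y (mk e) with euclidsLemma x y prime (m%n≡0⇒n∣m (x * y) p e)
  ... | inj₁ p∣x = inj₁ (mk (n∣m⇒m%n≡0 x p p∣x))
  ... | inj₂ p∣y = inj₂ (mk (n∣m⇒m%n≡0 y p p∣y))

  invertible : ∀ {x} → ¬ x ≈ 0 → Invertible x
  invertible {x} x≉0 = from-Bézout (coprime-Bézout (prime⇒coprime prime {{r≢0}} (m%n<n x p)))
    where
    open ≈-Reasoning
    r = x % p
    r≢0 : NonZero r
    r≢0 = ≢-nonZero (λ e → x≉0 (mk e))
    from-Bézout : Bézout.Identity 1 p r → Invertible x
    from-Bézout (Bézout.+- a b eq) = b * q , (begin
      x * (b * q)    ≈⟨ *-congʳ (b * q) (%-≈ x) ⟨
      r * (b * q)    ≡⟨ regroup r b q ⟩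
      (b * r) * q    ≈⟨ *-congʳ q br≈q ⟩
      (q * 1) * q    ≡⟨ cong (_* q) (ℕP.*-identityʳ q) ⟩
      q * q          ≈⟨ q*q≈1 ⟩
      1              ∎)
      where
      regroup : ∀ r b q → r * (b * q) ≡ (b * r) * q
      regroup = solve-∀
      br≈q : b * r ≈ q * 1
      br≈q = Equivalence.to +≈0⇔ (begin
        b * r + 1    ≡⟨ ℕP.+-comm (b * r) 1 ⟩
        1 + b * r    ≡⟨ eq ⟩
        a * p        ≈⟨ +-multiple 0 a ⟩
        0            ∎)
    from-Bézout (Bézout.-+ a b eq) = b , (begin
      x * b          ≈⟨ *-congʳ b (%-≈ x) ⟨
      r * b          ≡⟨ ℕP.*-comm r b ⟩
      b * r          ≡⟨ eq ⟨
      1 + a * p      ≈⟨ +-multiple 1 a ⟩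
      1              ∎)

  ≉-neg : suc q ≢ 2 → ∀ {a} → ¬ a ≈ 0 → ¬ a ≈ q * a
  ≉-neg p≢2 {a} a≉0 a≈-a = Sum.[ below-p≉0 2<p , a≉0 ] (euclid 2 a 2a≈0)
    where
    double : ∀ a → 2 * a ≡ a + a
    double = solve-∀
    2a≈0 : 2 * a ≈ 0
    2a≈0 = ≈-trans (≡⇒≈ (double a)) (Equivalence.from +≈0⇔ a≈-a)
    2<p : 2 < p
    2<p = ℕP.≤∧≢⇒< 1<p (λ 2≡p → p≢2 (sym 2≡p))

  square-roots : ∀ {y a} → y * y ≈ a * a → y ≈ a ⊎ y ≈ q * a
  square-roots {y} {a} y²≈a² =
    Sum.map (λ e → ≈-trans (Equivalence.to +≈0⇔ e) (neg-involutive a)) (Equivalence.to +≈0⇔)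
            (euclid (y + q * a) (y + a) factored)
    where
    open ≈-Reasoning
    expand : ∀ q y a → (y + q * a) * (y + a) ≡ y * y + q * (a * a) + (a * y) * suc q
    expand = solve-∀
    collect : ∀ q a → a * a + q * (a * a) ≡ 0 + (a * a) * suc q
    collect = solve-∀
    factored : (y + q * a) * (y + a) ≈ 0
    factored = begin
      (y + q * a) * (y + a)                ≡⟨ expand q y a ⟩
      y * y + q * (a * a) + (a * y) * p    ≈⟨ +-multiple _ (a * y) ⟩
      y * y + q * (a * a)                  ≈⟨ +-congʳ (q * (a * a)) y²≈a² ⟩
      a * a + q * (a * a)                  ≡⟨ collect q a ⟩
      0 + (a * a) * p                      ≈⟨ +-multiple 0 (a * a) ⟩
      0                                    ∎

  neg-square : ∀ {y a} → y ≈ q * a → y * y ≈ a * a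
  neg-square {y} {a} y≈-a = begin
    y * y                  ≈⟨ *-cong y≈-a y≈-a ⟩
    (q * a) * (q * a)      ≡⟨ regroup q a ⟩
    (q * q) * (a * a)      ≈⟨ *-congʳ (a * a) q*q≈1 ⟩
    1 * (a * a)            ≡⟨ ℕP.*-identityˡ (a * a) ⟩
    a * a                  ∎
    where
    open ≈-Reasoning
    regroup : ∀ q a → (q * a) * (q * a) ≡ (q * q) * (a * a)
    regroup = solve-∀

module PrimeSums (q : ℕ) (prime : Prime (suc q)) where

  open Residues q
  open PrimeField q prime
  open ResidueSums q
  open FiniteSums using (𝟙-yes; 𝟙-no)
  open import Data.Nat as ℕ using ()
  import Data.Nat.Properties as ℕP
  open import Data.Integer using (ℤ; +_; 1ℤ; _+_; _*_; _-_)
  import Data.Integer.Properties as ℤP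
  open import Data.Integer.Tactic.RingSolver using (solve-∀)
  open import Data.Sum using ([_,_])
  open import Relation.Nullary using (¬_; yes; no)
  open import Relation.Binary.PropositionalEquality using (_≡_; refl; sym; trans; cong; cong₂; module ≡-Reasoning)

  ⟦*≉0⟧ : ∀ x y → ⟦ x ℕ.* y ≉ 0 ⟧ ≡ ⟦ x ≉ 0 ⟧ * ⟦ y ≉ 0 ⟧
  ⟦*≉0⟧ x y with x ≈? 0 | y ≈? 0
  ... | yes x≈0 | _       = 𝟙-no (λ xy≉0 → xy≉0 (*-congʳ y x≈0)) _
  ... | no _    | yes y≈0 = 𝟙-no (λ xy≉0 → xy≉0 (≈-trans (*-congˡ x y≈0) (≡⇒≈ (ℕP.*-zeroʳ x)))) _
  ... | no x≉0  | no y≉0  = 𝟙-yes (λ xy≈0 → [ x≉0 , y≉0 ] (euclid x y xy≈0)) _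

  ∑-scale : ∀ {f} → Respects≈ f → ∀ {u} → ¬ u ≈ 0 → ∑ₚ (λ x → f (u ℕ.* x)) ≡ ∑ₚ f
  ∑-scale {f} f-resp {u} u≉0 = trans (∑ₚ-cong (λ x → f-resp (≡⇒≈ (sym (ℕP.+-identityʳ (u ℕ.* x))))))
                                      (∑-affine f-resp u (invertible u≉0) 0)

  -- Σ_b Σ_c f(b·c): the row b ≈ 0 contributes p·f(0), each of the q other
  -- rows is a permutation of all residues.
  ∑-product : ∀ {f} → Respects≈ f → ∑ₚ (λ b → ∑ₚ (λ c → f (b ℕ.* c))) ≡ + p * f 0 + + q * ∑ₚ f
  ∑-product {f} f-resp = begin
    ∑ₚ (λ b → ∑ₚ (λ c → f (b ℕ.* c)))
      ≡⟨ ∑ₚ-cong row ⟩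
    ∑ₚ (λ b → ∑ₚ f + ⟦ b ≈ 0 ⟧ * (+ p * f 0 - ∑ₚ f))
      ≡⟨ ∑ₚ-+ (λ _ → ∑ₚ f) (λ b → ⟦ b ≈ 0 ⟧ * (+ p * f 0 - ∑ₚ f)) ⟩
    ∑ₚ (λ _ → ∑ₚ f) + ∑ₚ (λ b → ⟦ b ≈ 0 ⟧ * (+ p * f 0 - ∑ₚ f))
      ≡⟨ cong₂ _+_ (∑ₚ-const (∑ₚ f)) (∑-delta (λ _ → refl) 0) ⟩
    + p * ∑ₚ f + (+ p * f 0 - ∑ₚ f)
      ≡⟨ collect (+ q) (∑ₚ f) (f 0) ⟩
    + p * f 0 + + q * ∑ₚ f ∎
    where
    open ≡-Reasoning
    collect : ∀ Q S F → (1ℤ + Q) * S + ((1ℤ + Q) * F - S) ≡ (1ℤ + Q) * F + Q * S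
    collect = solve-∀
    row : ∀ b → ∑ₚ (λ c → f (b ℕ.* c)) ≡ ∑ₚ f + ⟦ b ≈ 0 ⟧ * (+ p * f 0 - ∑ₚ f)
    row b with b ≈? 0
    ... | yes b≈0 = trans (∑ₚ-cong (λ c → f-resp (*-congʳ c b≈0)))
                          (trans (∑ₚ-const (f 0)) (sym (restore (∑ₚ f) (+ p * f 0))))
      where
      restore : ∀ S P → S + 1ℤ * (P - S) ≡ P
      restore = solve-∀
    ... | no b≉0  = trans (∑-scale f-resp b≉0) (sym (ℤP.+-identityʳ (∑ₚ f)))

-- The quadratic character χ = (·/p) of an odd prime p = q + 1.  Counting
-- square roots (each non-zero square has exactly two) shows Σ χ = 0.
module QuadraticCharacter (q : ℕ) (prime : Prime (suc q)) (p≢2 : suc q ≢ 2) where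

  open Residues q
  open PrimeField q prime
  open ResidueSums q
  open PrimeSums q prime
  open FiniteSums using (𝟙-cong; 𝟙-yes; 𝟙-no)
  open import Data.Nat as ℕ using (_%_)
  import Data.Nat.Properties as ℕP
  open import Data.Integer using (ℤ; +_; 0ℤ; 1ℤ; -1ℤ; _+_; _*_)
  import Data.Integer.Properties as ℤP
  open import Data.Fin using (toℕ)
  open import Data.Product using (_,_)
  open import Data.Sum using (_⊎_; inj₁; inj₂; [_,_]; reduce)
  open import Function using (_⇔_; mk⇔)
  open import Relation.Nullary using (¬_; yes; no; contradiction)
  open import Relation.Binary.PropositionalEquality using (_≡_; refl; sym; trans; cong; cong₂; module ≡-Reasoning)
  open import Algebra.Properties.AbelianGroup ℤP.+-0-abelianGroup using (∙-cancelˡ)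
  open import Defs using (legendre; isSquareMod?)

  χ : ℕ → ℤ
  χ = legendre p

  χ-values : ∀ x → χ x ≡ 0ℤ ⊎ χ x ≡ 1ℤ ⊎ χ x ≡ -1ℤ
  χ-values x with x % p ℕP.≟ 0
  ... | yes _ = inj₁ refl
  ... | no _ with isSquareMod? p x
  ...   | yes _ = inj₂ (inj₁ refl)
  ...   | no _  = inj₂ (inj₂ refl)

  χ-resp : Respects≈ χ
  χ-resp {x} {y} (mk e) with x % p ℕP.≟ 0 | y % p ℕP.≟ 0
  ... | yes _   | yes _   = refl
  ... | yes x≡0 | no y≢0  = contradiction (trans (sym e) x≡0) y≢0
  ... | no x≢0  | yes y≡0 = contradiction (trans e y≡0) x≢0
  ... | no _    | no _ with isSquareMod? p x | isSquareMod? p y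
  ...   | yes _        | yes _        = refl
  ...   | no _         | no _         = refl
  ...   | yes (r , rx) | no ¬sq       = contradiction (r , trans rx e) ¬sq
  ...   | no ¬sq       | yes (r , ry) = contradiction (r , trans ry (sym e)) ¬sq

  χ-one : χ 1 ≡ 1ℤ
  χ-one with 1 % p ℕP.≟ 0
  ... | yes 1≡0 = contradiction (mk 1≡0) 1≉0
  ... | no _ with isSquareMod? p 1
  ...   | yes _  = refl
  ...   | no ¬sq = contradiction (fm 1 , _≈_.same-rem (*-cong (toℕ-fm 1) (toℕ-fm 1))) ¬sq

  two-roots : ∀ {a} → ¬ a ≈ 0 → ∀ y → ⟦ y ℕ.* y ≈ a ℕ.* a ⟧ ≡ ⟦ y ≈ a ⟧ + ⟦ y ≈ q ℕ.* a ⟧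
  two-roots {a} a≉0 y with y ≈? a | y ≈? q ℕ.* a
  ... | yes y≈a | yes y≈-a = contradiction (≈-trans (≈-sym y≈a) y≈-a) (≉-neg p≢2 a≉0)
  ... | yes y≈a | no _     = 𝟙-yes (*-cong y≈a y≈a) _
  ... | no _    | yes y≈-a = 𝟙-yes (neg-square y≈-a) _
  ... | no y≉a  | no y≉-a  = 𝟙-no (λ y²≈a² → [ y≉a , y≉-a ] (square-roots y²≈a²)) _

  roots : ∀ m → ∑ₚ (λ y → ⟦ y ℕ.* y ≈ m ⟧) ≡ 1ℤ + χ m
  roots m with m % p ℕP.≟ 0
  ... | yes m≡0 = trans (∑ₚ-cong (λ y → 𝟙-cong (square≈0 y) (y ℕ.* y ≈? m) (y ≈? 0))) (∑-point 0)
    where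
    square≈0 : ∀ y → y ℕ.* y ≈ m ⇔ y ≈ 0
    square≈0 y = mk⇔ (λ e → reduce (euclid y y (≈-trans e (mk m≡0))))
                     (λ y≈0 → ≈-trans (*-congʳ y y≈0) (≈-sym (mk m≡0)))
  ... | no m≢0 with isSquareMod? p m
  ...   | no ¬sq = trans (∑ₚ-cong (λ y → 𝟙-no (not-root y) (y ℕ.* y ≈? m))) (trans (∑ₚ-const 0ℤ) (ℤP.*-zeroʳ (+ p)))
    where
    not-root : ∀ y → ¬ y ℕ.* y ≈ m
    not-root y y²≈m = ¬sq (fm y , _≈_.same-rem (≈-trans (*-cong (toℕ-fm y) (toℕ-fm y)) y²≈m))
  ...   | yes (r , r²≡m) = begin
    ∑ₚ (λ y → ⟦ y ℕ.* y ≈ m ⟧)                      ≡⟨ ∑ₚ-cong (λ y → ⟦≈⟧-respects {y ℕ.* y} ≈-refl (≈-sym a²≈m)) ⟩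
    ∑ₚ (λ y → ⟦ y ℕ.* y ≈ a ℕ.* a ⟧)                ≡⟨ ∑ₚ-cong (two-roots a≉0) ⟩
    ∑ₚ (λ y → ⟦ y ≈ a ⟧ + ⟦ y ≈ q ℕ.* a ⟧)          ≡⟨ ∑ₚ-+ (λ y → ⟦ y ≈ a ⟧) (λ y → ⟦ y ≈ q ℕ.* a ⟧) ⟩
    ∑ₚ (λ y → ⟦ y ≈ a ⟧) + ∑ₚ (λ y → ⟦ y ≈ q ℕ.* a ⟧) ≡⟨ cong₂ _+_ (∑-point a) (∑-point (q ℕ.* a)) ⟩
    1ℤ + 1ℤ                                          ∎
    where
    open ≡-Reasoning
    a = toℕ r
    a²≈m : a ℕ.* a ≈ m
    a²≈m = mk r²≡m
    a≉0 : ¬ a ≈ 0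
    a≉0 a≈0 = m≢0 (_≈_.same-rem (≈-trans (≈-sym a²≈m) (*-congʳ a a≈0)))

  -- Σ_m #{y : y² ≈ m} counts every y once, so p = Σ_m (1 + χ m) = p + Σ χ.
  ∑χ : ∑ₚ χ ≡ 0ℤ
  ∑χ = ∙-cancelˡ (+ p * 1ℤ) (∑ₚ χ) 0ℤ (begin
    + p * 1ℤ + ∑ₚ χ                         ≡⟨ cong (_+ ∑ₚ χ) (∑ₚ-const 1ℤ) ⟨
    ∑ₚ (λ _ → 1ℤ) + ∑ₚ χ                    ≡⟨ ∑ₚ-+ (λ _ → 1ℤ) χ ⟨
    ∑ₚ (λ m → 1ℤ + χ m)                     ≡⟨ ∑ₚ-cong roots ⟨
    ∑ₚ (λ m → ∑ₚ (λ y → ⟦ y ℕ.* y ≈ m ⟧))   ≡⟨ ∑ₚ-comm (λ m y → ⟦ y ℕ.* y ≈ m ⟧) ⟩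
    ∑ₚ (λ y → ∑ₚ (λ m → ⟦ y ℕ.* y ≈ m ⟧))   ≡⟨ ∑ₚ-cong (λ y → one-square y) ⟩
    ∑ₚ (λ _ → 1ℤ)                           ≡⟨ ∑ₚ-const 1ℤ ⟩
    + p * 1ℤ                                ≡⟨ ℤP.+-identityʳ (+ p * 1ℤ) ⟨
    + p * 1ℤ + 0ℤ                           ∎)
    where
    open ≡-Reasoning
    one-square : ∀ y → ∑ₚ (λ m → ⟦ y ℕ.* y ≈ m ⟧) ≡ 1ℤ
    one-square y = trans (∑ₚ-cong (λ m → 𝟙-cong (mk⇔ ≈-sym ≈-sym) (y ℕ.* y ≈? m) (m ≈? y ℕ.* y)))
                         (∑-point (y ℕ.* y))

  ∑χ-scaled : ∀ {u} → ¬ u ≈ 0 → ∑ₚ (λ x → χ (u ℕ.* x)) ≡ 0ℤ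
  ∑χ-scaled u≉0 = trans (∑-scale χ-resp u≉0) ∑χ

module WeightedCount (q : ℕ) (prime : Prime (suc q)) where

  open Residues q
  open PrimeField q prime
  open ResidueSums q
  open PrimeSums q prime
  open FiniteSums using (𝟙; 𝟙-cong; 𝟙-yes; 𝟙-no; 𝟙-×; listSum; listSum-filter; listSum-cartesian; listSum-allFin)
  open import Data.Nat as ℕ using ()
  import Data.Nat.Properties as ℕP
  open import Data.Integer using (ℤ; +_; 0ℤ; 1ℤ; _+_; _*_; _-_)
  import Data.Integer.Properties as ℤP
  open import Data.Integer.Tactic.RingSolver using (solve-∀)
  open import Data.Fin using (Fin; toℕ)
  open import Data.Product using (_,_)
  open import Function using (_⇔_; mk⇔; Equivalence)
  open import Function.Related.TypeIsomorphisms using (¬-cong-⇔)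
  open import Data.Sum using ([_,_]′)
  open import Relation.Nullary using (¬_)
  open import Relation.Nullary.Decidable using (¬?; toSum)
  open import Relation.Binary.PropositionalEquality using (_≡_; refl; sym; trans; cong; cong₂; module ≡-Reasoning)
  open import Algebra.Properties.Semiring.Sum ℤP.+-*-semiring using (sum; sum-cong-≗)
  open import Defs using (Mat2; allMat2; subMod; detMod; inΦ?; Φ)

  listSum-allMat2 : ∀ (f : Mat2 p → ℤ) →
    listSum (allMat2 p) f ≡ sum (λ a → sum (λ b → sum (λ c → sum (λ d → f (a , b , c , d)))))
  listSum-allMat2 f = begin
    listSum (allMat2 p) f
      ≡⟨ peel Fin³ f ⟩
    sum (λ a → listSum (Fin³) (λ bcd → f (a , bcd)))
      ≡⟨ sum-cong-≗ {p} (λ a → peel Fin² (λ bcd → f (a , bcd))) ⟩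
    sum (λ a → sum (λ b → listSum (Fin²) (λ cd → f (a , b , cd))))
      ≡⟨ sum-cong-≗ {p} (λ a → sum-cong-≗ {p} (λ b → peel (allFin p) (λ cd → f (a , b , cd)))) ⟩
    sum (λ a → sum (λ b → sum (λ c → listSum (allFin p) (λ d → f (a , b , c , d)))))
      ≡⟨ sum-cong-≗ {p} (λ a → sum-cong-≗ {p} (λ b → sum-cong-≗ {p} (λ c →
           listSum-allFin p (λ d → f (a , b , c , d))))) ⟩
    sum (λ a → sum (λ b → sum (λ c → sum (λ d → f (a , b , c , d))))) ∎
    where
    open ≡-Reasoning
    open import Data.List using (List; allFin; cartesianProduct)
    Fin² = cartesianProduct (allFin p) (allFin p)
    Fin³ = cartesianProduct (allFin p) Fin²
    peel : ∀ {A : Set} (ys : List A) (f : Fin p Data.Product.× A → ℤ) →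
      listSum (cartesianProduct (allFin p) ys) f ≡ sum (λ a → listSum ys (λ y → f (a , y)))
    peel ys f = trans (listSum-cartesian (allFin p) ys f) (listSum-allFin p (λ a → listSum ys (λ y → f (a , y))))

  -- I(x) = 1 iff x ∉ {0, 1}: the diagonal entries of the diagonal
  -- matrices in Φ_p.
  I : ℕ → ℤ
  I x = ⟦ x ≉ 0 ⟧ * ⟦ x ≉ 1 ⟧

  -- I vanishes at 0, so a factor I(x) lets us assume x ≉ 0.
  I-guard : ∀ x {u v} → (¬ x ≈ 0 → u ≡ v) → I x * u ≡ I x * v
  I-guard x {u} {v} u≡v = [ at-zero , (λ x≉0 → cong (I x *_) (u≡v x≉0)) ]′ (toSum (x ≈? 0))
    where
    I≡0 : x ≈ 0 → I x ≡ 0ℤ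
    I≡0 x≈0 = cong (_* ⟦ x ≉ 1 ⟧) (𝟙-no (λ x≉0 → x≉0 x≈0) (¬? (x ≈? 0)))
    at-zero : x ≈ 0 → I x * u ≡ I x * v
    at-zero x≈0 = trans (cong (_* u) (I≡0 x≈0)) (sym (cong (_* v) (I≡0 x≈0)))

  ∑-I : ∀ {f} → Respects≈ f → ∑ₚ (λ x → I x * f x) ≡ ∑ₚ f - f 0 - f 1
  ∑-I {f} f-resp = begin
    ∑ₚ (λ x → I x * f x)                          ≡⟨ ∑ₚ-cong (λ x → swap ⟦ x ≉ 0 ⟧ ⟦ x ≉ 1 ⟧ (f x)) ⟩
    ∑ₚ (λ x → ⟦ x ≉ 1 ⟧ * (⟦ x ≉ 0 ⟧ * f x))      ≡⟨ ∑-except (restrict-respects f-resp 0) 1 ⟩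
    ∑ₚ (λ x → ⟦ x ≉ 0 ⟧ * f x) - ⟦ 1 ≉ 0 ⟧ * f 1 ≡⟨ cong₂ _-_ (∑-except f-resp 0)
                                                               (cong (_* f 1) (𝟙-yes 1≉0 (¬? (1 ≈? 0)))) ⟩
    ∑ₚ f - f 0 - 1ℤ * f 1                          ≡⟨ cong (∑ₚ f - f 0 -_) (ℤP.*-identityˡ (f 1)) ⟩
    ∑ₚ f - f 0 - f 1                               ∎
    where
    open ≡-Reasoning
    swap : ∀ a b c → a * b * c ≡ b * (a * c)
    swap = solve-∀

  module _ (h : ℕ → ℤ) (h-resp : Respects≈ h) where

    Z : ℕ → ℤ
    Z u = ⟦ u ≉ 0 ⟧ * h u

    -- The contribution of matrices with diagonal (a, d), as a function
    -- of the product k = b·c of the off-diagonal entries.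
    module Diagonal (a d : ℕ) where

      X Y s : ℕ
      X = subMod p 1 a
      Y = subMod p 1 d
      s = subMod p (a ℕ.* d) (X ℕ.* Y)

      F : ℕ → ℤ
      F k = ⟦ X ℕ.* Y ≉ k ⟧ * (⟦ a ℕ.* d ≉ k ⟧ * h (subMod p (a ℕ.* d) k))

      F-resp : Respects≈ F
      F-resp k≈k′ = cong₂ _*_ (⟦≉⟧-respects {X ℕ.* Y} ≈-refl k≈k′)
                              (cong₂ _*_ (⟦≉⟧-respects {a ℕ.* d} ≈-refl k≈k′) (h-resp (sub-congʳ (a ℕ.* d) k≈k′)))

      F-as-u : ∀ k → F k ≡ ⟦ subMod p (a ℕ.* d) k ≉ s ⟧ * Z (subMod p (a ℕ.* d) k)
      F-as-u k = cong₂ _*_ (⟦≉⟧-cong {X ℕ.* Y} {u} {k} {s} u≈s⇔)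
                           (cong (_* h u) (⟦≉⟧-cong {a ℕ.* d} {u} {k} {0} sub≈⇔′))
        where
        u = subMod p (a ℕ.* d) k
        u≈s⇔ : X ℕ.* Y ≈ k ⇔ u ≈ s
        u≈s⇔ = mk⇔ (λ e → Equivalence.from (sub-cancelˡ⇔ {a ℕ.* d}) (≈-sym e))
                   (λ e → ≈-sym (Equivalence.to (sub-cancelˡ⇔ {a ℕ.* d}) e))
        sub≈⇔′ : a ℕ.* d ≈ k ⇔ u ≈ 0
        sub≈⇔′ = mk⇔ (Equivalence.from sub≈⇔) (Equivalence.to sub≈⇔)

      ∑F : ∑ₚ F ≡ ∑ₚ Z - Z s
      ∑F = begin
        ∑ₚ F                                 ≡⟨ ∑ₚ-cong (λ k → trans (F-as-u k) (G-resp (u≈ k))) ⟩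
        ∑ₚ (λ k → G (q ℕ.* k ℕ.+ a ℕ.* d))   ≡⟨ ∑-affine G-resp q (q , q*q≈1) (a ℕ.* d) ⟩
        ∑ₚ G                                 ≡⟨ ∑-except (restrict-respects h-resp 0) s ⟩
        ∑ₚ Z - Z s                           ∎
        where
        open ≡-Reasoning
        G : ℕ → ℤ
        G u = ⟦ u ≉ s ⟧ * Z u
        -- k ↦ ad − k is the affine map k ↦ q·k + ad
        u≈ : ∀ k → subMod p (a ℕ.* d) k ≈ q ℕ.* k ℕ.+ a ℕ.* d
        u≈ k = ≈-trans (sub≈ (a ℕ.* d) k) (≡⇒≈ (ℕP.+-comm (a ℕ.* d) (q ℕ.* k)))
        G-resp : Respects≈ G
        G-resp = restrict-respects (restrict-respects h-resp 0) s

      -- k = 0: the diagonal matrix diag(a, d) lies in Φ_p iff a, d ∉ {0, 1}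
      F0 : F 0 ≡ I a * (I d * h (a ℕ.* d))
      F0 = begin
        ⟦ X ℕ.* Y ≉ 0 ⟧ * (⟦ a ℕ.* d ≉ 0 ⟧ * h (subMod p (a ℕ.* d) 0))
          ≡⟨ cong₂ _*_ (trans (⟦*≉0⟧ X Y) (cong₂ _*_ (X≉0 a) (X≉0 d)))
                       (cong₂ _*_ (⟦*≉0⟧ a d) (h-resp ad-0≈ad)) ⟩
        (⟦ a ≉ 1 ⟧ * ⟦ d ≉ 1 ⟧) * ((⟦ a ≉ 0 ⟧ * ⟦ d ≉ 0 ⟧) * h (a ℕ.* d))
          ≡⟨ regroup ⟦ a ≉ 0 ⟧ ⟦ a ≉ 1 ⟧ ⟦ d ≉ 0 ⟧ ⟦ d ≉ 1 ⟧ (h (a ℕ.* d)) ⟩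
        I a * (I d * h (a ℕ.* d)) ∎
        where
        open ≡-Reasoning
        X≉0 : ∀ x → ⟦ subMod p 1 x ≉ 0 ⟧ ≡ ⟦ x ≉ 1 ⟧
        X≉0 x = ⟦≉⟧-cong {subMod p 1 x} {x} {0} {1}
                  (mk⇔ (λ e → ≈-sym (Equivalence.to sub≈⇔ e)) (λ e → Equivalence.from sub≈⇔ (≈-sym e)))
        ad-0≈ad : subMod p (a ℕ.* d) 0 ≈ a ℕ.* d
        ad-0≈ad = Equivalence.from sub≈⇔ (≡⇒≈ (sym (ℕP.+-identityʳ (a ℕ.* d))))
        regroup : ∀ a₀ a₁ d₀ d₁ H → (a₁ * d₁) * ((a₀ * d₀) * H) ≡ (a₀ * a₁) * ((d₀ * d₁) * H)
        regroup = solve-∀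

      ∑-off-diagonal : ∑ₚ (λ b → ∑ₚ (λ c → F (b ℕ.* c))) ≡ + p * (I a * (I d * h (a ℕ.* d))) + + q * (∑ₚ Z - Z s)
      ∑-off-diagonal = trans (∑-product F-resp) (cong₂ (λ t u → + p * t + + q * u) F0 ∑F)

    -- Σ_d Z(s(a, d)) = Σ Z, since s(a, d) ≈ d + (a − 1) is a translate of d.
    ∑-shift : ∀ a → ∑ₚ (λ d → Z (Diagonal.s a d)) ≡ ∑ₚ Z
    ∑-shift a = trans (∑ₚ-cong (λ d → restrict-respects h-resp 0 (diagonal-shift a d)))
                      (∑-affine (restrict-respects h-resp 0) 1 (1 , ≈-refl) (a ℕ.+ q))

    ∑-row : ∀ a → ∑ₚ (λ d → + p * (I a * (I d * h (a ℕ.* d))) + + q * (∑ₚ Z - Z (Diagonal.s a d)))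
                  ≡ + p * (I a * ∑ₚ (λ d → I d * h (a ℕ.* d))) + + q * + q * ∑ₚ Z
    ∑-row a = begin
      ∑ₚ (λ d → + p * T d + + q * (∑ₚ Z - Z (s d)))
        ≡⟨ ∑ₚ-+ (λ d → + p * T d) (λ d → + q * (∑ₚ Z - Z (s d))) ⟩
      ∑ₚ (λ d → + p * T d) + ∑ₚ (λ d → + q * (∑ₚ Z - Z (s d)))
        ≡⟨ cong₂ _+_ (∑ₚ-*ˡ (+ p) T) (trans (∑ₚ-*ˡ (+ q) (λ d → ∑ₚ Z - Z (s d)))
                                            (cong (+ q *_) (∑ₚ-− (λ _ → ∑ₚ Z) (λ d → Z (s d))))) ⟩
      + p * ∑ₚ T + + q * (∑ₚ (λ _ → ∑ₚ Z) - ∑ₚ (λ d → Z (s d)))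
        ≡⟨ cong₂ (λ t u → + p * t + + q * u) (∑ₚ-*ˡ (I a) (λ d → I d * h (a ℕ.* d)))
                                          (cong₂ _-_ (∑ₚ-const (∑ₚ Z)) (∑-shift a)) ⟩
      + p * (I a * ∑ₚ (λ d → I d * h (a ℕ.* d))) + + q * (+ p * ∑ₚ Z - ∑ₚ Z)
        ≡⟨ cong (λ t → + p * (I a * ∑ₚ (λ d → I d * h (a ℕ.* d))) + t) (collect (+ q) (∑ₚ Z)) ⟩
      + p * (I a * ∑ₚ (λ d → I d * h (a ℕ.* d))) + + q * + q * ∑ₚ Z ∎
      where
      open ≡-Reasoning
      T : ℕ → ℤ
      T d = I a * (I d * h (a ℕ.* d))
      s : ℕ → ℕ
      s = Diagonal.s a
      collect : ∀ Q C → Q * ((1ℤ + Q) * C - C) ≡ Q * Q * C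
      collect = solve-∀

    W : Mat2 p → ℤ
    W g = 𝟙 (inΦ? p g) * h (detMod p g)

    W-diagonal : ∀ a b c d → W (a , b , c , d) ≡ Diagonal.F (toℕ a) (toℕ d) (toℕ b ℕ.* toℕ c)
    W-diagonal a b c d = begin
      𝟙 (¬? (det ℕP.≟ 0) ×-dec ¬? (det₁ ℕP.≟ 0)) * h det
        ≡⟨ cong (_* h det) (𝟙-× (¬? (det ℕP.≟ 0)) (¬? (det₁ ℕP.≟ 0))) ⟩
      𝟙 (¬? (det ℕP.≟ 0)) * 𝟙 (¬? (det₁ ℕP.≟ 0)) * h det
        ≡⟨ cong₂ (λ α β → α * β * h det) (≢0⇔≉ (A ℕ.* D) K) (≢0⇔≉ (X ℕ.* Y) K) ⟩
      ⟦ A ℕ.* D ≉ K ⟧ * ⟦ X ℕ.* Y ≉ K ⟧ * h det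
        ≡⟨ swap ⟦ A ℕ.* D ≉ K ⟧ ⟦ X ℕ.* Y ≉ K ⟧ (h det) ⟩
      Diagonal.F A D K ∎
      where
      open ≡-Reasoning
      open import Relation.Nullary.Decidable using (_×-dec_)
      A = toℕ a
      D = toℕ d
      K = toℕ b ℕ.* toℕ c
      X = subMod p 1 A
      Y = subMod p 1 D
      det = subMod p (A ℕ.* D) K
      det₁ = subMod p (X ℕ.* Y) K
      ≢0⇔≉ : ∀ x y → 𝟙 (¬? (subMod p x y ℕP.≟ 0)) ≡ ⟦ x ≉ y ⟧
      ≢0⇔≉ x y = 𝟙-cong (¬-cong-⇔ sub≡0⇔) (¬? (subMod p x y ℕP.≟ 0)) (¬? (x ≈? y))
      swap : ∀ α β H → α * β * H ≡ β * (α * H)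
      swap = solve-∀

    weighted-count : listSum (Φ p) (λ g → h (detMod p g))
      ≡ + p * (+ q * + q * (∑ₚ h - h 0) + ∑ₚ (λ a → I a * ∑ₚ (λ d → I d * h (a ℕ.* d))))
    weighted-count = begin
      listSum (Φ p) (λ g → h (detMod p g))
        ≡⟨ listSum-filter (inΦ? p) (allMat2 p) (λ g → h (detMod p g)) ⟩
      listSum (allMat2 p) W
        ≡⟨ listSum-allMat2 W ⟩
      sum (λ a → sum (λ b → sum (λ c → sum (λ d → W (a , b , c , d)))))
        ≡⟨ sum-cong-≗ {p} (λ a → sum-cong-≗ {p} (λ b → sum-cong-≗ {p} (λ c →
             sum-cong-≗ {p} (λ d → W-diagonal a b c d)))) ⟩
      ∑ₚ (λ a → ∑ₚ (λ b → ∑ₚ (λ c → ∑ₚ (λ d → Diagonal.F a d (b ℕ.* c)))))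
        ≡⟨ ∑ₚ-cong (λ a → diagonal-outside (λ b c d → Diagonal.F a d (b ℕ.* c))) ⟩
      ∑ₚ (λ a → ∑ₚ (λ d → ∑ₚ (λ b → ∑ₚ (λ c → Diagonal.F a d (b ℕ.* c)))))
        ≡⟨ ∑ₚ-cong (λ a → trans (∑ₚ-cong (Diagonal.∑-off-diagonal a)) (∑-row a)) ⟩
      ∑ₚ (λ a → + p * U a + + q * + q * ∑ₚ Z)
        ≡⟨ ∑ₚ-+ (λ a → + p * U a) (λ _ → + q * + q * ∑ₚ Z) ⟩
      ∑ₚ (λ a → + p * U a) + ∑ₚ (λ _ → + q * + q * ∑ₚ Z)
        ≡⟨ cong₂ _+_ (∑ₚ-*ˡ (+ p) U) (∑ₚ-const (+ q * + q * ∑ₚ Z)) ⟩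
      + p * ∑ₚ U + + p * (+ q * + q * ∑ₚ Z)
        ≡⟨ factor (+ p) (∑ₚ U) (+ q * + q * ∑ₚ Z) ⟩
      + p * (+ q * + q * ∑ₚ Z + ∑ₚ U)
        ≡⟨ cong (λ C → + p * (+ q * + q * C + ∑ₚ U)) (∑-except h-resp 0) ⟩
      + p * (+ q * + q * (∑ₚ h - h 0) + ∑ₚ U) ∎
      where
      open ≡-Reasoning
      U : ℕ → ℤ
      U a = I a * ∑ₚ (λ d → I d * h (a ℕ.* d))
      factor : ∀ P S K → P * S + P * K ≡ P * (K + S)
      factor = solve-∀
      diagonal-outside : ∀ (f : ℕ → ℕ → ℕ → ℤ) →
        ∑ₚ (λ b → ∑ₚ (λ c → ∑ₚ (λ d → f b c d))) ≡ ∑ₚ (λ d → ∑ₚ (λ b → ∑ₚ (λ c → f b c d)))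
      diagonal-outside f = trans (∑ₚ-cong (λ b → ∑ₚ-comm (f b))) (∑ₚ-comm (λ b d → ∑ₚ (λ c → f b c d)))

module Lemma5p8 (q : ℕ) (prime : Prime (suc q)) (p≢2 : suc q ≢ 2) where

  open Residues q
  open ResidueSums q
  open QuadraticCharacter q prime p≢2
  open WeightedCount q prime
  open FiniteSums using (listSum; length-listSum; signed-count; ∑-neg)
  open import Data.Nat as ℕ using (_^_)
  import Data.Nat.Properties as ℕP
  open import Data.Integer using (ℤ; +_; 0ℤ; 1ℤ; _+_; _*_; _-_; -_)
  import Data.Integer.Properties as ℤP
  open import Data.Integer.Tactic.RingSolver using (solve-∀)
  open import Data.Fin using (toℕ)
  open import Data.List using (length)
  open import Relation.Binary.PropositionalEquality using (_≡_; refl; sym; trans; cong; cong₂; module ≡-Reasoning)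
  open import Defs using (Φ; ψ; countψΦ; detMod)

  ∑-I-const : ∀ c → ∑ₚ (λ x → I x * c) ≡ + p * c - c - c
  ∑-I-const c = trans (∑-I {λ _ → c} (λ _ → refl)) (cong (λ t → t - c - c) (∑ₚ-const c))

  cardinality : + length (Φ p) ≡ + p * ((+ (p ^ 3) - + 2 * + (p ^ 2)) - + p + + 3)
  cardinality = begin
    + length (Φ p)
      ≡⟨ length-listSum (Φ p) ⟩
    listSum (Φ p) (λ _ → 1ℤ)
      ≡⟨ weighted-count (λ _ → 1ℤ) (λ _ → refl) ⟩
    + p * (+ q * + q * (∑ₚ (λ _ → 1ℤ) - 1ℤ) + ∑ₚ (λ a → I a * ∑ₚ (λ d → I d * 1ℤ)))
      ≡⟨ cong₂ (λ t u → + p * (+ q * + q * (t - 1ℤ) + u)) (∑ₚ-const 1ℤ)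
               (trans (∑ₚ-cong (λ a → cong (I a *_) (∑-I-const 1ℤ))) (∑-I-const (+ p * 1ℤ - 1ℤ - 1ℤ))) ⟩
    + p * (+ q * + q * (+ p * 1ℤ - 1ℤ) + (+ p * N - N - N))
      ≡⟨ closed-form (+ q) ⟩
    + p * ((+ p * (+ p * (+ p * 1ℤ)) - + 2 * (+ p * (+ p * 1ℤ))) - + p + + 3)
      ≡⟨ cong₂ (λ t u → + p * ((t - + 2 * u) - + p + + 3)) (sym pow³) (sym pow²) ⟩
    + p * ((+ (p ^ 3) - + 2 * + (p ^ 2)) - + p + + 3) ∎
    where
    open ≡-Reasoning
    N : ℤ
    N = + p * 1ℤ - 1ℤ - 1ℤ
    -- with p = 1 + q:  p·(q²·(p − 1) + (p − 2)²) = p·(p³ − 2p² − p + 3)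
    closed-form : ∀ Q → (1ℤ + Q) * (Q * Q * ((1ℤ + Q) * 1ℤ - 1ℤ)
                          + ((1ℤ + Q) * ((1ℤ + Q) * 1ℤ - 1ℤ - 1ℤ) - ((1ℤ + Q) * 1ℤ - 1ℤ - 1ℤ) - ((1ℤ + Q) * 1ℤ - 1ℤ - 1ℤ)))
                      ≡ (1ℤ + Q) * (((1ℤ + Q) * ((1ℤ + Q) * ((1ℤ + Q) * 1ℤ)) - + 2 * ((1ℤ + Q) * ((1ℤ + Q) * 1ℤ))) - (1ℤ + Q) + + 3)
    closed-form = solve-∀
    pow² : + (p ^ 2) ≡ + p * (+ p * 1ℤ)
    pow² = trans (ℤP.pos-* p (p ^ 1)) (cong (+ p *_) (ℤP.pos-* p 1))
    pow³ : + (p ^ 3) ≡ + p * (+ p * (+ p * 1ℤ))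
    pow³ = trans (ℤP.pos-* p (p ^ 2)) (cong (+ p *_) pow²)

  ∑∑χ : ∑ₚ (λ a → I a * ∑ₚ (λ d → I d * χ (a ℕ.* d))) ≡ 1ℤ
  ∑∑χ = begin
    ∑ₚ (λ a → I a * ∑ₚ (λ d → I d * χ (a ℕ.* d)))  ≡⟨ ∑ₚ-cong row ⟩
    ∑ₚ (λ a → I a * - χ a)                          ≡⟨ ∑-I (λ x≈y → cong -_ (χ-resp x≈y)) ⟩
    ∑ₚ (λ a → - χ a) - - χ 0 - - χ 1                ≡⟨ cong₂ (λ t u → t - - χ 0 - - u) ∑-negχ χ-one ⟩
    1ℤ                                              ∎
    where
    open ≡-Reasoning
    ∑-negχ : ∑ₚ (λ a → - χ a) ≡ - 0ℤ
    ∑-negχ = trans (∑-neg {p} (λ k → χ (toℕ k))) (cong -_ ∑χ)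
    -- for a ≉ 0: Σ_{d ∉ {0,1}} χ(ad) = Σ_d χ(ad) − χ(0) − χ(a) = −χ(a)
    row : ∀ a → I a * ∑ₚ (λ d → I d * χ (a ℕ.* d)) ≡ I a * - χ a
    row a = I-guard a (λ a≉0 → begin
      ∑ₚ (λ d → I d * χ (a ℕ.* d))                       ≡⟨ ∑-I (λ x≈y → χ-resp (*-congˡ a x≈y)) ⟩
      ∑ₚ (λ d → χ (a ℕ.* d)) - χ (a ℕ.* 0) - χ (a ℕ.* 1) ≡⟨ cong₂ (λ t u → t - u - χ (a ℕ.* 1))
                                                              (∑χ-scaled a≉0) (cong χ (ℕP.*-zeroʳ a)) ⟩
      0ℤ - 0ℤ - χ (a ℕ.* 1)                              ≡⟨ ℤP.+-identityˡ (- χ (a ℕ.* 1)) ⟩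
      - χ (a ℕ.* 1)                                      ≡⟨ cong (λ t → - χ t) (ℕP.*-identityʳ a) ⟩
      - χ a                                              ∎)

  signed-cardinality : + countψΦ p (+ 1) - + countψΦ p (- + 1) ≡ + p
  signed-cardinality = begin
    + countψΦ p (+ 1) - + countψΦ p (- + 1)
      ≡⟨ signed-count (ψ p) (λ g → χ-values (detMod p g)) (Φ p) ⟩
    listSum (Φ p) (ψ p)
      ≡⟨ weighted-count χ χ-resp ⟩
    + p * (+ q * + q * (∑ₚ χ - χ 0) + ∑ₚ (λ a → I a * ∑ₚ (λ d → I d * χ (a ℕ.* d))))
      ≡⟨ cong₂ (λ t u → + p * (+ q * + q * (t - χ 0) + u)) ∑χ ∑∑χ ⟩
    + p * (+ q * + q * (0ℤ - 0ℤ) + 1ℤ)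
      ≡⟨ collapse (+ p) (+ q) ⟩
    + p ∎
    where
    open ≡-Reasoning
    collapse : ∀ P Q → P * (Q * Q * (0ℤ - 0ℤ) + 1ℤ) ≡ P
    collapse = solve-∀

open import Data.Nat using (ℕ; _+_; _*_; _∸_; _^_; NonZero)
open import Data.Nat.Primality using (Prime)
open import Data.List using (length)
open import Data.Integer using (ℤ; +_; _-_)
open import Data.Product using (_×_; _,_)
open import Relation.Binary.PropositionalEquality using (_≡_; _≢_)
open import Defs

lemma5p8 : (p : ℕ) → .{{_ : NonZero p}} → Prime p → p ≢ 2 →
    (+ length (Φ p) ≡ + p Data.Integer.* ((+ p ^ 3 - + 2 Data.Integer.* + p ^ 2) - + p Data.Integer.+ + 3))
    × (+ countψΦ p (+ 1) - + countψΦ p (Data.Integer.- + 1) ≡ + p)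
lemma5p8 zero {{()}}
lemma5p8 (suc q) p-prime p≢2 = cardinality , signed-cardinality
  where open Lemma5p8 q p-prime p≢2
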